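{- Let $n\ge0$ and let $w_1,w_2\in\mathbb{N}$ with $w_1\equiv1\pmod2$ and $w_2\equiv1\pmod2$. Then, for all $x$ (as an identity of polynomials in $x$), \[ \sum_{l=0}^{w_1-1}(-1)^lC_{n,w_1}\!\left(w_2x+\frac{w_2}{w_1}l\right)=\sum_{l=0}^{w_2-1}(-1)^lC_{n,w_2}\!\left(w_1x+\frac{w_1}{w_2}l\right). \]
   Context: For $w\in\mathbb{N}$, the $w$-Catalan polynomials $C_{n,w}(x)$ are defined by the generating function $\frac{2}{1+(1-4t)^{w/2}}(1-4t)^{\frac{w}{2}x}=\sum_{n\ge0}C_{n,w}(x)t^n$, where $(1-4t)^{a}=\sum_{k\ge0}\binom{a}{k}(-4t)^k$ and $\binom{a}{k}=\frac{a(a-1)\cdots(a-k+1)}{k!}$. -}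

module Defs where

open import Data.Nat as ℕ using (ℕ; zero; suc)
open import Data.Integer as ℤ using (ℤ; +_)
open import Data.Rational using (ℚ; _+_; _*_; _-_; -_; _/_; 0ℚ; 1ℚ; ½)
open import Data.List using (List; []; _∷_)

ι : ℕ → ℚ
ι n = + n / 1

-- a / b as a rational (b = 0 never occurs in the uses below: b is odd)
frac : ℕ → ℕ → ℚ
frac a zero    = 0ℚ
frac a (suc b) = + a / suc b

gbinom : ℚ → ℕ → ℚ
gbinom a zero    = 1ℚ
gbinom a (suc k) = gbinom a k * (a - ι k) * (+ 1 / suc k)

-- k-th coefficient of (1-4t)^a = binom(a,k) (-4)^k
powCoeff : ℚ → ℕ → ℚ
powCoeff a k = gbinom a k * ((ℤ.-[1+ 3 ] ℤ.^ k) / 1)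

conv : (ℕ → ℚ) → ℕ → List ℚ → ℚ
conv S j []       = 0ℚ
conv S j (x ∷ xs) = S (suc j) * x + conv S (suc j) xs

-- For a series S with S(0) = 1, the list [g_n, ..., g_0] of coefficients of
-- g = 2/(1+S), determined by (1+S) g = 2, i.e.
-- g_0 = 1,  g_{n} = -(1/2) Σ_{k=1}^{n} S_k g_{n-k}.
twoOverOnePlusList : (ℕ → ℚ) → ℕ → List ℚ
twoOverOnePlusList S zero    = 1ℚ ∷ []
twoOverOnePlusList S (suc n) =
  (- (½ * conv S 0 (twoOverOnePlusList S n))) ∷ twoOverOnePlusList S n

headℚ : List ℚ → ℚ
headℚ []      = 0ℚ
headℚ (x ∷ _) = x

-- n-th coefficient of 2/(1+(1-4t)^{w/2})
catPrefactor : ℕ → ℕ → ℚ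
catPrefactor w n = headℚ (twoOverOnePlusList (powCoeff (frac w 2)) n)

sumTo : ℕ → (ℕ → ℚ) → ℚ
sumTo zero    f = f 0
sumTo (suc n) f = sumTo n f + f (suc n)

sumBelow : ℕ → (ℕ → ℚ) → ℚ
sumBelow zero    f = 0ℚ
sumBelow (suc m) f = sumBelow m f + f m

-- w-Catalan polynomial C_{n,w}(x): coefficient of t^n in
-- 2/(1+(1-4t)^{w/2}) · (1-4t)^{(w/2) x}
C : ℕ → ℕ → ℚ → ℚ
C n w x = sumTo n (λ k → catPrefactor w k * powCoeff (frac w 2 * x) (n ℕ.∸ k))

sgn : ℕ → ℚ
sgn l = (ℤ.-[1+ 0 ] ℤ.^ l) / 1

module Submission where

-- Formal power series over ℚ are represented by their
-- coefficient functions ℕ → ℚ and multiplied by the Cauchy product _⋆_.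
-- Write  β(c) = (1-4t)^c = Σ binom(c,k) (-4)^k t^k  and  G_w = 2/(1+β(w/2)),
-- so that by definition  Σ_n C_{n,w}(x) t^n = G_w · β(wx/2).
--
--  * β(a)·β(b) = β(a+b): both sides solve the recurrence
--    (n+1) f_{n+1} = 4(n-c) f_n with f_0 = 1 (c = a+b), whose solution is
--    unique; the product rule for t·d/dt shows products of solutions solve it.
--  * For w₁ = suc b₁ the argument shift (w₁/2)(w₂x + (w₂/w₁) l) = c + l (w₂/2),
--    c = w₁w₂x/2, turns the l-th summand into the series G_{w₁} β(c) β(w₂/2)^l.
--  * The alternating geometric sum Σ_{l<w₁} (-1)^l q^l times (1+q) telescopes
--    to 1 + q^{w₁} for odd w₁; with q = β(w₂/2) we have (1+q) G_{w₂} = 2.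
--
-- Hence 2·LHS is the n-th coefficient of G_{w₁} G_{w₂} β(c) (1 + β(w₁w₂/2)),
-- which is symmetric in w₁ and w₂; cancelling the factor 2 gives theorem5.

open import Defs
open import Data.Nat as ℕ using (ℕ; zero; suc; _%_)
open import Data.Nat.DivMod using (m≡m%n+[m/n]*n)
open import Data.Integer as ℤ using (+_)
open import Data.Rational using (ℚ; _+_; _*_; -_; _/_; 0ℚ; 1ℚ; ½; fromℚᵘ)
open import Data.Rational.Properties
  using ( toℚᵘ-injective; toℚᵘ-fromℚᵘ; toℚᵘ-homo-*; toℚᵘ-homo-+; fromℚᵘ-cong
        ; +-identityˡ; +-identityʳ; +-assoc; +-comm
        ; *-identityˡ; *-zeroˡ; *-zeroʳ; *-assoc; *-comm; *-distribˡ-+; *-distribʳ-+ )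
import Data.Rational.Unnormalised as U
import Data.Rational.Unnormalised.Properties as UP
open import Data.Rational.Solver using (module +-*-Solver)
open +-*-Solver using (solve; _:=_; _:+_; _:*_; :-_; con)
import Data.Nat.Properties as ℕP
import Data.Integer.Properties as ℤP
open import Relation.Binary.PropositionalEquality
  using (_≡_; _≗_; refl; sym; trans; cong; cong₂; module ≡-Reasoning)
open ≡-Reasoning

-- Normalisation of unnormalised rationals respects + and *; this is how
-- literal fractions i / d are computed with.
fromℚᵘ-homo-* : ∀ p q → fromℚᵘ (p U.* q) ≡ fromℚᵘ p * fromℚᵘ q
fromℚᵘ-homo-* p q = toℚᵘ-injective (UP.≃-trans (toℚᵘ-fromℚᵘ (p U.* q))
  (UP.≃-sym (UP.≃-trans (toℚᵘ-homo-* (fromℚᵘ p) (fromℚᵘ q))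
     (UP.*-cong (toℚᵘ-fromℚᵘ p) (toℚᵘ-fromℚᵘ q)))))

fromℚᵘ-homo-+ : ∀ p q → fromℚᵘ (p U.+ q) ≡ fromℚᵘ p + fromℚᵘ q
fromℚᵘ-homo-+ p q = toℚᵘ-injective (UP.≃-trans (toℚᵘ-fromℚᵘ (p U.+ q))
  (UP.≃-sym (UP.≃-trans (toℚᵘ-homo-+ (fromℚᵘ p) (fromℚᵘ q))
     (UP.+-cong (toℚᵘ-fromℚᵘ p) (toℚᵘ-fromℚᵘ q)))))

/1-homo-* : ∀ i j → (i ℤ.* j) / 1 ≡ (i / 1) * (j / 1)
/1-homo-* i j = fromℚᵘ-homo-* (U.mkℚᵘ i 0) (U.mkℚᵘ j 0)

/1-homo-+ : ∀ i j → (i ℤ.+ j) / 1 ≡ (i / 1) + (j / 1)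
/1-homo-+ i j =
  trans (cong (_/ 1) (sym (cong₂ ℤ._+_ (ℤP.*-identityʳ i) (ℤP.*-identityʳ j))))
        (fromℚᵘ-homo-+ (U.mkℚᵘ i 0) (U.mkℚᵘ j 0))

ι-suc : ∀ k → ι (suc k) ≡ 1ℚ + ι k
ι-suc k = trans (cong (_/ 1) (ℤP.pos-+ 1 k)) (/1-homo-+ (+ 1) (+ k))

frac-by-two : ∀ a → frac a 2 ≡ ι a * ½
frac-by-two a = trans (cong (_/ 2) (sym (ℤP.*-identityʳ (+ a))))
                      (fromℚᵘ-homo-* (U.mkℚᵘ (+ a) 0) (U.mkℚᵘ (+ 1) 1))

frac-by-suc : ∀ a b → frac a (suc b) ≡ ι a * (+ 1 / suc b)
frac-by-suc a b = begin
  + a / suc b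
    ≡⟨ cong (_/ suc b) (sym (ℤP.*-identityʳ (+ a))) ⟩
  fromℚᵘ (U.mkℚᵘ (+ a ℤ.* + 1) b)
    ≡⟨ cong (λ k → fromℚᵘ (U.mkℚᵘ (+ a ℤ.* + 1) k)) (sym (cong ℕ.pred (ℕP.*-identityˡ (suc b)))) ⟩
  fromℚᵘ (U.mkℚᵘ (+ a) 0 U.* U.mkℚᵘ (+ 1) b)
    ≡⟨ fromℚᵘ-homo-* (U.mkℚᵘ (+ a) 0) (U.mkℚᵘ (+ 1) b) ⟩
  ι a * (+ 1 / suc b)   ∎

ι-suc-inverse : ∀ b → ι (suc b) * (+ 1 / suc b) ≡ 1ℚ
ι-suc-inverse b =
  trans (sym (fromℚᵘ-homo-* (U.mkℚᵘ (+ suc b) 0) (U.mkℚᵘ (+ 1) b)))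
        (fromℚᵘ-cong {U.mkℚᵘ (+ suc b) 0 U.* U.mkℚᵘ (+ 1) b} {U.mkℚᵘ (+ 1) 0} (U.*≡* cross))
  where
  cross : (+ suc b ℤ.* + 1) ℤ.* + 1 ≡ + 1 ℤ.* U.↧ (U.mkℚᵘ (+ suc b) 0 U.* U.mkℚᵘ (+ 1) b)
  cross = trans (ℤP.*-identityʳ _) (trans (ℤP.*-identityʳ _)
            (sym (trans (ℤP.*-identityˡ _) (cong +_ (ℕP.*-identityˡ (suc b))))))

ι-suc-cancelˡ : ∀ n a b → ι (suc n) * a ≡ ι (suc n) * b → a ≡ b
ι-suc-cancelˡ n a b e = trans (sym (undo a)) (trans (cong ((+ 1 / suc n) *_) e) (undo b))
  where
  undo : ∀ y → (+ 1 / suc n) * (ι (suc n) * y) ≡ y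
  undo y = trans (solve 3 (λ s r y → s :* (r :* y) := (r :* s) :* y) refl (+ 1 / suc n) (ι (suc n)) y)
                 (trans (cong (_* y) (ι-suc-inverse n)) (*-identityˡ y))

two four minusOne minusFour : ℚ
two       = ι 2
four      = ι 4
minusOne  = ℤ.-[1+ 0 ] / 1
minusFour = ℤ.-[1+ 3 ] / 1

sgn-suc : ∀ l → sgn (suc l) ≡ minusOne * sgn l
sgn-suc l = /1-homo-* ℤ.-[1+ 0 ] (ℤ.-[1+ 0 ] ℤ.^ l)

sgn-even : ∀ k → sgn (k ℕ.* 2) ≡ 1ℚ
sgn-even zero    = refl
sgn-even (suc k) = begin
  sgn (suc (suc (k ℕ.* 2)))               ≡⟨ sgn-suc (suc (k ℕ.* 2)) ⟩
  minusOne * sgn (suc (k ℕ.* 2))          ≡⟨ cong (minusOne *_) (sgn-suc (k ℕ.* 2)) ⟩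
  minusOne * (minusOne * sgn (k ℕ.* 2))   ≡⟨ cong (λ s → minusOne * (minusOne * s)) (sgn-even k) ⟩
  1ℚ                                      ∎

-- (-1)^{w+1} = 1 for odd w; this is where the parity hypotheses enter.
sgn-suc-odd : ∀ w → w % 2 ≡ 1 → sgn (suc w) ≡ 1ℚ
sgn-suc-odd w odd =
  trans (cong (λ v → sgn (suc v)) (trans (m≡m%n+[m/n]*n w 2) (cong (ℕ._+ (w ℕ./ 2) ℕ.* 2) odd)))
        (sgn-even (suc (w ℕ./ 2)))

minusFour^-suc : ∀ k → (ℤ.-[1+ 3 ] ℤ.^ suc k) / 1 ≡ minusFour * ((ℤ.-[1+ 3 ] ℤ.^ k) / 1)
minusFour^-suc k = /1-homo-* ℤ.-[1+ 3 ] (ℤ.-[1+ 3 ] ℤ.^ k)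

-- Formal power series and the Cauchy product

Series : Set
Series = ℕ → ℚ

-- (f(t) - f(0)) / t
shift : Series → Series
shift f k = f (suc k)

-- Cauchy product, by recursion on the first factor: fg = f₀ g + t (shift f) g.
infixl 7 _⋆_
_⋆_ : Series → Series → Series
(f ⋆ g) zero    = f 0 * g 0
(f ⋆ g) (suc n) = f 0 * g (suc n) + (shift f ⋆ g) n

infixl 6 _⊕_
_⊕_ : Series → Series → Series
(f ⊕ g) k = f k + g k

scale : ℚ → Series → Series
scale c f k = c * f k

𝟘 𝟙 : Series
𝟘 k = 0ℚ
𝟙 zero    = 1ℚ
𝟙 (suc k) = 0ℚ

⋆-cong : ∀ {f f′ g g′} → f ≗ f′ → g ≗ g′ → f ⋆ g ≗ f′ ⋆ g′
⋆-cong ef eg zero    = cong₂ _*_ (ef 0) (eg 0)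
⋆-cong ef eg (suc n) = cong₂ _+_ (cong₂ _*_ (ef 0) (eg (suc n))) (⋆-cong (λ k → ef (suc k)) eg n)

⋆-congˡ : ∀ {f f′} g → f ≗ f′ → f ⋆ g ≗ f′ ⋆ g
⋆-congˡ g ef = ⋆-cong ef (λ _ → refl)

⋆-congʳ : ∀ f {g g′} → g ≗ g′ → f ⋆ g ≗ f ⋆ g′
⋆-congʳ f eg = ⋆-cong (λ _ → refl) eg

⋆-distribʳ-⊕ : ∀ f g h → (f ⊕ g) ⋆ h ≗ f ⋆ h ⊕ g ⋆ h
⋆-distribʳ-⊕ f g h zero    = *-distribʳ-+ (h 0) (f 0) (g 0)
⋆-distribʳ-⊕ f g h (suc n) =
  trans (cong (_+_ ((f 0 + g 0) * h (suc n))) (⋆-distribʳ-⊕ (shift f) (shift g) h n))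
        (solve 5 (λ a b c x y → (a :+ b) :* c :+ (x :+ y) := (a :* c :+ x) :+ (b :* c :+ y)) refl
               (f 0) (g 0) (h (suc n)) ((shift f ⋆ h) n) ((shift g ⋆ h) n))

⋆-distribˡ-⊕ : ∀ f g h → f ⋆ (g ⊕ h) ≗ f ⋆ g ⊕ f ⋆ h
⋆-distribˡ-⊕ f g h zero    = *-distribˡ-+ (f 0) (g 0) (h 0)
⋆-distribˡ-⊕ f g h (suc n) =
  trans (cong (_+_ (f 0 * (g (suc n) + h (suc n)))) (⋆-distribˡ-⊕ (shift f) g h n))
        (solve 5 (λ a b c x y → a :* (b :+ c) :+ (x :+ y) := (a :* b :+ x) :+ (a :* c :+ y)) refl
               (f 0) (g (suc n)) (h (suc n)) ((shift f ⋆ g) n) ((shift f ⋆ h) n))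

⋆-scaleˡ : ∀ c f g → scale c f ⋆ g ≗ scale c (f ⋆ g)
⋆-scaleˡ c f g zero    = *-assoc c (f 0) (g 0)
⋆-scaleˡ c f g (suc n) =
  trans (cong (_+_ (c * f 0 * g (suc n))) (⋆-scaleˡ c (shift f) g n))
        (solve 4 (λ c a b x → c :* a :* b :+ c :* x := c :* (a :* b :+ x)) refl
               c (f 0) (g (suc n)) ((shift f ⋆ g) n))

⋆-scaleʳ : ∀ c f g → f ⋆ scale c g ≗ scale c (f ⋆ g)
⋆-scaleʳ c f g zero    = solve 3 (λ c a b → a :* (c :* b) := c :* (a :* b)) refl c (f 0) (g 0)
⋆-scaleʳ c f g (suc n) =
  trans (cong (_+_ (f 0 * (c * g (suc n)))) (⋆-scaleʳ c (shift f) g n))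
        (solve 4 (λ c a b x → a :* (c :* b) :+ c :* x := c :* (a :* b :+ x)) refl
               c (f 0) (g (suc n)) ((shift f ⋆ g) n))

⋆-zeroˡ : ∀ g → 𝟘 ⋆ g ≗ 𝟘
⋆-zeroˡ g zero    = *-zeroˡ (g 0)
⋆-zeroˡ g (suc n) = trans (cong (_+_ (0ℚ * g (suc n))) (⋆-zeroˡ g n))
                          (trans (+-identityʳ (0ℚ * g (suc n))) (*-zeroˡ (g (suc n))))

⋆-identityˡ : ∀ g → 𝟙 ⋆ g ≗ g
⋆-identityˡ g zero    = *-identityˡ (g 0)
⋆-identityˡ g (suc n) = trans (cong (_+_ (1ℚ * g (suc n))) (⋆-zeroˡ g n))
                              (trans (+-identityʳ (1ℚ * g (suc n))) (*-identityˡ (g (suc n))))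

⋆-suc-last : ∀ f g n → (f ⋆ g) (suc n) ≡ (f ⋆ shift g) n + f (suc n) * g 0
⋆-suc-last f g zero    = refl
⋆-suc-last f g (suc n) =
  trans (cong (_+_ (f 0 * g (suc (suc n)))) (⋆-suc-last (shift f) g n))
        (sym (+-assoc (f 0 * g (suc (suc n))) ((shift f ⋆ shift g) n) (f (suc (suc n)) * g 0)))

⋆-comm : ∀ f g → f ⋆ g ≗ g ⋆ f
⋆-comm f g zero    = *-comm (f 0) (g 0)
⋆-comm f g (suc n) =
  trans (cong₂ _+_ (*-comm (f 0) (g (suc n))) (⋆-comm (shift f) g n))
        (trans (+-comm (g (suc n) * f 0) ((g ⋆ shift f) n)) (sym (⋆-suc-last g f n)))

⋆-identityʳ : ∀ g → g ⋆ 𝟙 ≗ g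
⋆-identityʳ g n = trans (⋆-comm g 𝟙 n) (⋆-identityˡ g n)

⋆-zeroʳ : ∀ f → f ⋆ 𝟘 ≗ 𝟘
⋆-zeroʳ f n = trans (⋆-comm f 𝟘 n) (⋆-zeroˡ f n)

⋆-assoc : ∀ f g h → (f ⋆ g) ⋆ h ≗ f ⋆ (g ⋆ h)
⋆-assoc f g h zero    = *-assoc (f 0) (g 0) (h 0)
⋆-assoc f g h (suc n) =
  trans (cong (_+_ (f 0 * g 0 * h (suc n)))
          (trans (⋆-distribʳ-⊕ (scale (f 0) (shift g)) (shift f ⋆ g) h n)
                 (cong₂ _+_ (⋆-scaleˡ (f 0) (shift g) h n) (⋆-assoc (shift f) g h n))))
        (solve 5 (λ a b c x y → a :* b :* c :+ (a :* x :+ y) := a :* (b :* c :+ x) :+ y) refl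
               (f 0) (g 0) (h (suc n)) ((shift g ⋆ h) n) ((shift f ⋆ (g ⋆ h)) n))

⋆-swapʳ : ∀ a b c → (a ⋆ b) ⋆ c ≗ (a ⋆ c) ⋆ b
⋆-swapʳ a b c n = begin
  ((a ⋆ b) ⋆ c) n   ≡⟨ ⋆-assoc a b c n ⟩
  (a ⋆ (b ⋆ c)) n   ≡⟨ ⋆-congʳ a (⋆-comm b c) n ⟩
  (a ⋆ (c ⋆ b)) n   ≡⟨ ⋆-assoc a c b n ⟨
  ((a ⋆ c) ⋆ b) n   ∎

-- Rearranging a product of four factors, used to bring G_{w₂} next to 1+β.
⋆-interchange : ∀ a b c d → (a ⋆ b) ⋆ (c ⋆ d) ≗ (a ⋆ d) ⋆ (b ⋆ c)
⋆-interchange a b c d n = begin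
  ((a ⋆ b) ⋆ (c ⋆ d)) n   ≡⟨ ⋆-assoc a b (c ⋆ d) n ⟩
  (a ⋆ (b ⋆ (c ⋆ d))) n   ≡⟨ ⋆-congʳ a (⋆-comm b (c ⋆ d)) n ⟩
  (a ⋆ ((c ⋆ d) ⋆ b)) n   ≡⟨ ⋆-congʳ a (⋆-swapʳ c d b) n ⟩
  (a ⋆ ((c ⋆ b) ⋆ d)) n   ≡⟨ ⋆-congʳ a (⋆-comm (c ⋆ b) d) n ⟩
  (a ⋆ (d ⋆ (c ⋆ b))) n   ≡⟨ ⋆-congʳ a (⋆-congʳ d (⋆-comm c b)) n ⟩
  (a ⋆ (d ⋆ (b ⋆ c))) n   ≡⟨ ⋆-assoc a d (b ⋆ c) n ⟨
  ((a ⋆ d) ⋆ (b ⋆ c)) n   ∎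

infixr 8 _^ₛ_
_^ₛ_ : Series → ℕ → Series
f ^ₛ zero  = 𝟙
f ^ₛ suc l = f ^ₛ l ⋆ f

-- The Euler operator t·d/dt is a derivation

euler : Series → Series
euler f k = ι k * f k

shift-euler : ∀ f → shift (euler f) ≗ shift f ⊕ euler (shift f)
shift-euler f k = begin
  ι (suc k) * f (suc k)                  ≡⟨ cong (_* f (suc k)) (ι-suc k) ⟩
  (1ℚ + ι k) * f (suc k)                 ≡⟨ *-distribʳ-+ (f (suc k)) 1ℚ (ι k) ⟩
  1ℚ * f (suc k) + ι k * f (suc k)       ≡⟨ cong (_+ ι k * f (suc k)) (*-identityˡ (f (suc k))) ⟩
  f (suc k) + ι k * f (suc k)            ∎

-- The ring identity behind the inductive step of the Leibniz rule.
leibniz-step : ∀ I i a b M A B → I ≡ 1ℚ + i → A + B ≡ i * M →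
  I * (a * b + M) ≡ (0ℚ * a) * b + (M + A) + (a * (I * b) + B)
leibniz-step I i a b M A B refl e = begin
  (1ℚ + i) * (a * b + M)
    ≡⟨ solve 4 (λ i a b M → (con 1ℚ :+ i) :* (a :* b :+ M) := (a :* b :+ M :+ i :* a :* b) :+ i :* M)
             refl i a b M ⟩
  (a * b + M + i * a * b) + i * M
    ≡⟨ cong (_+_ (a * b + M + i * a * b)) (sym e) ⟩
  (a * b + M + i * a * b) + (A + B)
    ≡⟨ solve 6 (λ i a b M A B → (a :* b :+ M :+ i :* a :* b) :+ (A :+ B)
                                := (con 0ℚ :* a) :* b :+ (M :+ A) :+ (a :* ((con 1ℚ :+ i) :* b) :+ B))
             refl i a b M A B ⟩
  (0ℚ * a) * b + (M + A) + (a * ((1ℚ + i) * b) + B)   ∎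

leibniz : ∀ f g → euler (f ⋆ g) ≗ euler f ⋆ g ⊕ f ⋆ euler g
leibniz f g zero =
  solve 2 (λ a b → con 0ℚ :* (a :* b) := (con 0ℚ :* a) :* b :+ a :* (con 0ℚ :* b)) refl (f 0) (g 0)
leibniz f g (suc n) =
  trans (leibniz-step (ι (suc n)) (ι n) (f 0) (g (suc n)) ((shift f ⋆ g) n)
           ((euler (shift f) ⋆ g) n) ((shift f ⋆ euler g) n) (ι-suc n) (sym (leibniz (shift f) g n)))
        (cong (λ z → (0ℚ * f 0) * g (suc n) + z + (f 0 * (ι (suc n) * g (suc n)) + (shift f ⋆ euler g) n))
              (sym (trans (⋆-congˡ g (shift-euler f) n) (⋆-distribʳ-⊕ (shift f) (euler (shift f)) g n))))

-- Binomial series  β(c) = (1-4t)^c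

-- The coefficient recurrence of (1-4t)^c, i.e. the differential equation
-- (1-4t) f′ = -4c f written coefficientwise.
BinomialRecurrence : ℚ → Series → Set
BinomialRecurrence c f = ∀ n → ι (suc n) * f (suc n) ≡ four * ((ι n + - c) * f n)

euler-⋆-recurrence : ∀ a f → BinomialRecurrence a f → ∀ g n →
  (euler f ⋆ g) (suc n) ≡ four * ((euler f ⋆ g) n + (- a) * (f ⋆ g) n)
euler-⋆-recurrence a f rec g n = begin
  0ℚ * f 0 * g (suc n) + (shift (euler f) ⋆ g) n
    ≡⟨ cong₂ _+_ (trans (cong (_* g (suc n)) (*-zeroˡ (f 0))) (*-zeroˡ (g (suc n))))
                 (⋆-congˡ g (λ k → trans (rec k) (expand k)) n) ⟩
  0ℚ + (scale four (euler f ⊕ scale (- a) f) ⋆ g) n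
    ≡⟨ +-identityˡ _ ⟩
  (scale four (euler f ⊕ scale (- a) f) ⋆ g) n
    ≡⟨ ⋆-scaleˡ four (euler f ⊕ scale (- a) f) g n ⟩
  four * ((euler f ⊕ scale (- a) f) ⋆ g) n
    ≡⟨ cong (four *_) (trans (⋆-distribʳ-⊕ (euler f) (scale (- a) f) g n)
                             (cong (_+_ ((euler f ⋆ g) n)) (⋆-scaleˡ (- a) f g n))) ⟩
  four * ((euler f ⋆ g) n + (- a) * (f ⋆ g) n)   ∎
  where
  expand : ∀ k → four * ((ι k + - a) * f k) ≡ four * (ι k * f k + (- a) * f k)
  expand k = solve 4 (λ F i a x → F :* ((i :+ :- a) :* x) := F :* (i :* x :+ (:- a) :* x)) refl
                     four (ι k) a (f k)

⋆-recurrence : ∀ a b f g → BinomialRecurrence a f → BinomialRecurrence b g →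
  BinomialRecurrence (a + b) (f ⋆ g)
⋆-recurrence a b f g recf recg n = begin
  ι (suc n) * (f ⋆ g) (suc n)
    ≡⟨ leibniz f g (suc n) ⟩
  (euler f ⋆ g) (suc n) + (f ⋆ euler g) (suc n)
    ≡⟨ cong₂ _+_ (euler-⋆-recurrence a f recf g n)
                 (trans (⋆-comm f (euler g) (suc n)) (euler-⋆-recurrence b g recg f n)) ⟩
  four * (X + (- a) * P) + four * ((euler g ⋆ f) n + (- b) * (g ⋆ f) n)
    ≡⟨ cong (λ z → four * (X + (- a) * P) + four * z)
            (cong₂ _+_ (⋆-comm (euler g) f n) (cong ((- b) *_) (⋆-comm g f n))) ⟩
  four * (X + (- a) * P) + four * (Y + (- b) * P)
    ≡⟨ solve 5 (λ P X Y a b → con four :* (X :+ (:- a) :* P) :+ con four :* (Y :+ (:- b) :* P)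
                              := con four :* (X :+ Y) :+ con four :* ((:- (a :+ b)) :* P)) refl P X Y a b ⟩
  four * (X + Y) + four * ((- (a + b)) * P)
    ≡⟨ cong (λ z → four * z + four * ((- (a + b)) * P)) (sym (leibniz f g n)) ⟩
  four * (ι n * P) + four * ((- (a + b)) * P)
    ≡⟨ solve 4 (λ i P a b → con four :* (i :* P) :+ con four :* ((:- (a :+ b)) :* P)
                            := con four :* ((i :+ :- (a :+ b)) :* P)) refl (ι n) P a b ⟩
  four * ((ι n + - (a + b)) * P)   ∎
  where
  P X Y : ℚ
  P = (f ⋆ g) n
  X = (euler f ⋆ g) n
  Y = (f ⋆ euler g) n

recurrence-unique : ∀ c f h → BinomialRecurrence c f → BinomialRecurrence c h →
  f 0 ≡ h 0 → f ≗ h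
recurrence-unique c f h recf rech e zero    = e
recurrence-unique c f h recf rech e (suc n) =
  ι-suc-cancelˡ n (f (suc n)) (h (suc n))
    (trans (recf n) (trans (cong (λ z → four * ((ι n + - c) * z)) (recurrence-unique c f h recf rech e n))
                           (sym (rech n))))

β : ℚ → Series
β c = powCoeff c

β-recurrence : ∀ c → BinomialRecurrence c (β c)
β-recurrence c n = begin
  ι (suc n) * ((g * (c + - ι n) * s) * ((ℤ.-[1+ 3 ] ℤ.^ suc n) / 1))
    ≡⟨ cong (λ z → ι (suc n) * ((g * (c + - ι n) * s) * z)) (minusFour^-suc n) ⟩
  ι (suc n) * ((g * (c + - ι n) * s) * (minusFour * p))
    ≡⟨ solve 6 (λ r s g c i p → r :* ((g :* (c :+ :- i) :* s) :* (con minusFour :* p))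
                                := (r :* s) :* (g :* (c :+ :- i) :* (con minusFour :* p)))
             refl (ι (suc n)) s g c (ι n) p ⟩
  (ι (suc n) * s) * (g * (c + - ι n) * (minusFour * p))
    ≡⟨ cong (_* (g * (c + - ι n) * (minusFour * p))) (ι-suc-inverse n) ⟩
  1ℚ * (g * (c + - ι n) * (minusFour * p))
    ≡⟨ solve 4 (λ g c i p → con 1ℚ :* (g :* (c :+ :- i) :* (con minusFour :* p))
                            := con four :* ((i :+ :- c) :* (g :* p))) refl g c (ι n) p ⟩
  four * ((ι n + - c) * (g * p))   ∎
  where
  g s p : ℚ
  g = gbinom c n
  s = + 1 / suc n
  p = (ℤ.-[1+ 3 ] ℤ.^ n) / 1

𝟙-recurrence : BinomialRecurrence 0ℚ 𝟙
𝟙-recurrence zero    = refl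
𝟙-recurrence (suc n) =
  trans (*-zeroʳ (ι (suc (suc n))))
        (sym (trans (cong (four *_) (*-zeroʳ (ι (suc n) + - 0ℚ))) (*-zeroʳ four)))

β-+ : ∀ a b → β a ⋆ β b ≗ β (a + b)
β-+ a b = recurrence-unique (a + b) (β a ⋆ β b) (β (a + b))
            (⋆-recurrence a b (β a) (β b) (β-recurrence a) (β-recurrence b)) (β-recurrence (a + b)) refl

β-0 : β 0ℚ ≗ 𝟙
β-0 = recurrence-unique 0ℚ (β 0ℚ) 𝟙 (β-recurrence 0ℚ) 𝟙-recurrence refl

β-*-ι : ∀ l b → β (ι l * b) ≗ β b ^ₛ l
β-*-ι zero    b n = trans (cong (λ z → β z n) (*-zeroˡ b)) (β-0 n)
β-*-ι (suc l) b n = begin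
  β (ι (suc l) * b) n       ≡⟨ cong (λ z → β z n) (trans (cong (_* b) (ι-suc l))
                                 (solve 2 (λ L b → (con 1ℚ :+ L) :* b := L :* b :+ b) refl (ι l) b)) ⟩
  β (ι l * b + b) n         ≡⟨ β-+ (ι l * b) b n ⟨
  (β (ι l * b) ⋆ β b) n     ≡⟨ ⋆-congˡ (β b) (β-*-ι l b) n ⟩
  (β b ^ₛ l ⋆ β b) n        ∎

-- The generating function of C_{n,w}

sumTo-split-first : ∀ n F → sumTo (suc n) F ≡ F 0 + sumTo n (λ k → F (suc k))
sumTo-split-first zero    F = refl
sumTo-split-first (suc n) F =
  trans (cong (_+ F (suc (suc n))) (sumTo-split-first n F)) (+-assoc (F 0) _ _)

sumTo-convolution : ∀ f h n → sumTo n (λ k → f k * h (n ℕ.∸ k)) ≡ (f ⋆ h) n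
sumTo-convolution f h zero    = refl
sumTo-convolution f h (suc n) =
  trans (sumTo-split-first n (λ k → f k * h (suc n ℕ.∸ k)))
        (cong (_+_ (f 0 * h (suc n))) (sumTo-convolution (shift f) h n))

G : ℕ → Series
G w k = catPrefactor w k

C-as-coefficient : ∀ n w y → C n w y ≡ (G w ⋆ β (frac w 2 * y)) n
C-as-coefficient n w y = sumTo-convolution (G w) (β (frac w 2 * y)) n

module Reciprocal (S : Series) (S0 : S 0 ≡ 1ℚ) where

  g : Series
  g k = headℚ (twoOverOnePlusList S k)

  conv-as-⋆ : ∀ j n → conv S j (twoOverOnePlusList S n) ≡ ((λ k → S (suc (k ℕ.+ j))) ⋆ g) n
  conv-as-⋆ j zero    = +-identityʳ (S (suc j) * 1ℚ)
  conv-as-⋆ j (suc n) = cong (_+_ (S (suc j) * g (suc n)))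
    (trans (conv-as-⋆ (suc j) n) (⋆-congˡ g (λ k → cong (λ z → S (suc z)) (ℕP.+-suc k j)) n))

  onePlus-⋆-reciprocal : (𝟙 ⊕ S) ⋆ g ≗ scale two 𝟙
  onePlus-⋆-reciprocal zero    = cong (λ z → (1ℚ + z) * 1ℚ) S0
  onePlus-⋆-reciprocal (suc n) = begin
    (1ℚ + S 0) * g (suc n) + (shift (𝟙 ⊕ S) ⋆ g) n
      ≡⟨ cong₂ (λ z w → (1ℚ + z) * g (suc n) + w) S0
               (⋆-congˡ g (λ k → trans (+-identityˡ (S (suc k)))
                                       (cong (λ z → S (suc z)) (sym (ℕP.+-identityʳ k)))) n) ⟩
    (1ℚ + 1ℚ) * g (suc n) + ((λ k → S (suc (k ℕ.+ 0))) ⋆ g) n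
      ≡⟨ cong (_+_ ((1ℚ + 1ℚ) * g (suc n))) (sym (conv-as-⋆ 0 n)) ⟩
    (1ℚ + 1ℚ) * (- (½ * K)) + K
      ≡⟨ solve 1 (λ K → (con 1ℚ :+ con 1ℚ) :* (:- (con ½ :* K)) :+ K := con two :* con 0ℚ) refl K ⟩
    two * 0ℚ   ∎
    where
    K : ℚ
    K = conv S 0 (twoOverOnePlusList S n)

G-reciprocal : ∀ w → (𝟙 ⊕ β (frac w 2)) ⋆ G w ≗ scale two 𝟙
G-reciprocal w = Reciprocal.onePlus-⋆-reciprocal (β (frac w 2)) refl

sumBelow-cong : ∀ m {F F′} → F ≗ F′ → sumBelow m F ≡ sumBelow m F′
sumBelow-cong zero    e = refl
sumBelow-cong (suc m) e = cong₂ _+_ (sumBelow-cong m e) (e m)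

alternatingSum : ℕ → (ℕ → Series) → Series
alternatingSum m Y k = sumBelow m (λ l → sgn l * Y l k)

⋆-alternatingSum : ∀ m P Y n →
  sumBelow m (λ l → sgn l * (P ⋆ Y l) n) ≡ (P ⋆ alternatingSum m Y) n
⋆-alternatingSum zero    P Y n = sym (⋆-zeroʳ P n)
⋆-alternatingSum (suc m) P Y n =
  trans (cong₂ _+_ (⋆-alternatingSum m P Y n) (sym (⋆-scaleʳ (sgn m) P (Y m) n)))
        (sym (⋆-distribˡ-⊕ P (alternatingSum m Y) (scale (sgn m) (Y m)) n))

alternating-geometric : ∀ q m →
  alternatingSum m (q ^ₛ_) ⋆ (𝟙 ⊕ q) ≗ 𝟙 ⊕ scale (sgn (suc m)) (q ^ₛ m)
alternating-geometric q zero n =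
  trans (⋆-zeroˡ (𝟙 ⊕ q) n) (solve 1 (λ x → con 0ℚ := x :+ con (sgn 1) :* x) refl (𝟙 n))
alternating-geometric q (suc m) n = begin
  (alternatingSum (suc m) (q ^ₛ_) ⋆ (𝟙 ⊕ q)) n
    ≡⟨ ⋆-distribʳ-⊕ (alternatingSum m (q ^ₛ_)) (scale (sgn m) (q ^ₛ m)) (𝟙 ⊕ q) n ⟩
  (alternatingSum m (q ^ₛ_) ⋆ (𝟙 ⊕ q)) n + (scale (sgn m) (q ^ₛ m) ⋆ (𝟙 ⊕ q)) n
    ≡⟨ cong₂ _+_ (alternating-geometric q m n)
                 (trans (⋆-scaleˡ (sgn m) (q ^ₛ m) (𝟙 ⊕ q) n)
                        (cong (sgn m *_) (trans (⋆-distribˡ-⊕ (q ^ₛ m) 𝟙 q n)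
                                                (cong (_+ Q′) (⋆-identityʳ (q ^ₛ m) n))))) ⟩
  𝟙 n + sgn (suc m) * Q + sgn m * (Q + Q′)
    ≡⟨ cong (λ z → 𝟙 n + z * Q + sgn m * (Q + Q′)) (sgn-suc m) ⟩
  𝟙 n + minusOne * sgn m * Q + sgn m * (Q + Q′)
    ≡⟨ solve 4 (λ o s P P′ → o :+ (con minusOne :* s) :* P :+ s :* (P :+ P′)
                             := o :+ (con minusOne :* (con minusOne :* s)) :* P′) refl (𝟙 n) (sgn m) Q Q′ ⟩
  𝟙 n + minusOne * (minusOne * sgn m) * Q′
    ≡⟨ cong (λ z → 𝟙 n + z * Q′) (sym (trans (sgn-suc (suc m)) (cong (minusOne *_) (sgn-suc m)))) ⟩
  𝟙 n + sgn (suc (suc m)) * Q′   ∎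
  where
  Q Q′ : ℚ
  Q  = (q ^ₛ m) n
  Q′ = (q ^ₛ suc m) n

-- (w₁/2)(w₂ x + (w₂/w₁) l) = w₁w₂x/2 + l (w₂/2): the shift by multiples of
-- w₂/w₁ becomes multiplication by powers of (1-4t)^{w₂/2}.
argument-shift : ∀ b₁ w₂ x l →
  frac (suc b₁) 2 * (ι w₂ * x + frac w₂ (suc b₁) * ι l)
    ≡ ι (suc b₁) * ι w₂ * (½ * x) + ι l * frac w₂ 2
argument-shift b₁ w₂ x l = begin
  frac w₁ 2 * (ι w₂ * x + frac w₂ w₁ * ι l)
    ≡⟨ cong₂ (λ p r → p * (ι w₂ * x + r * ι l)) (frac-by-two w₁) (frac-by-suc w₂ b₁) ⟩
  (ι w₁ * ½) * (ι w₂ * x + (ι w₂ * s) * ι l)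
    ≡⟨ solve 5 (λ W₁ W₂ x s L → (W₁ :* con ½) :* (W₂ :* x :+ (W₂ :* s) :* L)
                                := W₁ :* W₂ :* (con ½ :* x) :+ (W₁ :* s) :* (L :* (W₂ :* con ½)))
             refl (ι w₁) (ι w₂) x s (ι l) ⟩
  ι w₁ * ι w₂ * (½ * x) + (ι w₁ * s) * (ι l * (ι w₂ * ½))
    ≡⟨ cong (λ z → ι w₁ * ι w₂ * (½ * x) + z * (ι l * (ι w₂ * ½))) (ι-suc-inverse b₁) ⟩
  ι w₁ * ι w₂ * (½ * x) + 1ℚ * (ι l * (ι w₂ * ½))
    ≡⟨ cong (_+_ (ι w₁ * ι w₂ * (½ * x))) (trans (*-identityˡ _) (cong (ι l *_) (sym (frac-by-two w₂)))) ⟩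
  ι w₁ * ι w₂ * (½ * x) + ι l * frac w₂ 2   ∎
  where
  w₁ : ℕ
  w₁ = suc b₁
  s : ℚ
  s = + 1 / suc b₁

alternatingCatalanSum : ℕ → ℕ → ℕ → ℚ → ℚ
alternatingCatalanSum n w₁ w₂ x = sumBelow w₁ (λ l → sgn l * C n w₁ (ι w₂ * x + frac w₂ w₁ * ι l))

-- 2 × (either side of theorem5), as the n-th coefficient of
-- G_{w₁} G_{w₂} (1-4t)^{w₁w₂x/2} (1 + (1-4t)^{w₁w₂/2}).
symmetricSeries : ℕ → ℕ → ℚ → Series
symmetricSeries w₁ w₂ x =
  (G w₁ ⋆ G w₂ ⋆ β (ι w₁ * ι w₂ * (½ * x))) ⋆ (𝟙 ⊕ β (ι w₁ * ι w₂ * ½))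

symmetricSeries-comm : ∀ w₁ w₂ x → symmetricSeries w₁ w₂ x ≗ symmetricSeries w₂ w₁ x
symmetricSeries-comm w₁ w₂ x n rewrite *-comm (ι w₁) (ι w₂) =
  ⋆-congˡ _ (⋆-congˡ _ (⋆-comm (G w₁) (G w₂))) n

module DoubledSide (n b₁ w₂ : ℕ) (x : ℚ) (odd₁ : suc b₁ % 2 ≡ 1) where

  w₁ : ℕ
  w₁ = suc b₁

  q V : Series
  q = β (frac w₂ 2)
  V = G w₁ ⋆ β (ι w₁ * ι w₂ * (½ * x))

  summand-as-coefficient : ∀ l →
    sgn l * C n w₁ (ι w₂ * x + frac w₂ w₁ * ι l) ≡ sgn l * (V ⋆ q ^ₛ l) n
  summand-as-coefficient l = cong (sgn l *_) (begin
    C n w₁ (ι w₂ * x + frac w₂ w₁ * ι l)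
      ≡⟨ C-as-coefficient n w₁ _ ⟩
    (G w₁ ⋆ β (frac w₁ 2 * (ι w₂ * x + frac w₂ w₁ * ι l))) n
      ≡⟨ ⋆-congʳ (G w₁) (λ k → cong (λ z → β z k) (argument-shift b₁ w₂ x l)) n ⟩
    (G w₁ ⋆ β (ι w₁ * ι w₂ * (½ * x) + ι l * frac w₂ 2)) n
      ≡⟨ ⋆-congʳ (G w₁) (λ k → sym (trans (⋆-congʳ _ (λ j → sym (β-*-ι l (frac w₂ 2) j)) k) (β-+ _ _ k))) n ⟩
    (G w₁ ⋆ (β (ι w₁ * ι w₂ * (½ * x)) ⋆ q ^ₛ l)) n
      ≡⟨ ⋆-assoc (G w₁) _ (q ^ₛ l) n ⟨
    (V ⋆ q ^ₛ l) n   ∎)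

  telescoped : alternatingSum w₁ (q ^ₛ_) ⋆ (𝟙 ⊕ q) ≗ 𝟙 ⊕ β (ι w₁ * ι w₂ * ½)
  telescoped k = begin
    (alternatingSum w₁ (q ^ₛ_) ⋆ (𝟙 ⊕ q)) k   ≡⟨ alternating-geometric q w₁ k ⟩
    𝟙 k + sgn (suc w₁) * (q ^ₛ w₁) k          ≡⟨ cong (λ z → 𝟙 k + z * (q ^ₛ w₁) k) (sgn-suc-odd w₁ odd₁) ⟩
    𝟙 k + 1ℚ * (q ^ₛ w₁) k                    ≡⟨ cong (_+_ (𝟙 k)) (*-identityˡ _) ⟩
    𝟙 k + (q ^ₛ w₁) k                         ≡⟨ cong (_+_ (𝟙 k)) (sym (β-*-ι w₁ (frac w₂ 2) k)) ⟩
    𝟙 k + β (ι w₁ * frac w₂ 2) k              ≡⟨ cong (λ z → 𝟙 k + β z k)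
                                                   (trans (cong (ι w₁ *_) (frac-by-two w₂)) (sym (*-assoc (ι w₁) (ι w₂) ½))) ⟩
    𝟙 k + β (ι w₁ * ι w₂ * ½) k               ∎

  doubled : two * alternatingCatalanSum n w₁ w₂ x ≡ symmetricSeries w₁ w₂ x n
  doubled = begin
    two * alternatingCatalanSum n w₁ w₂ x
      ≡⟨ cong (two *_) (trans (sumBelow-cong w₁ summand-as-coefficient) (⋆-alternatingSum w₁ V (q ^ₛ_) n)) ⟩
    two * (V ⋆ Σq) n                           ≡⟨ cong (two *_) (⋆-identityʳ (V ⋆ Σq) n) ⟨
    two * (V ⋆ Σq ⋆ 𝟙) n                       ≡⟨ ⋆-scaleʳ two (V ⋆ Σq) 𝟙 n ⟨
    (V ⋆ Σq ⋆ scale two 𝟙) n                   ≡⟨ ⋆-congʳ (V ⋆ Σq) (G-reciprocal w₂) n ⟨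
    (V ⋆ Σq ⋆ ((𝟙 ⊕ q) ⋆ G w₂)) n              ≡⟨ ⋆-interchange V Σq (𝟙 ⊕ q) (G w₂) n ⟩
    (V ⋆ G w₂ ⋆ (Σq ⋆ (𝟙 ⊕ q))) n              ≡⟨ ⋆-congʳ (V ⋆ G w₂) telescoped n ⟩
    (V ⋆ G w₂ ⋆ (𝟙 ⊕ β (ι w₁ * ι w₂ * ½))) n   ≡⟨ ⋆-congˡ _ (⋆-swapʳ (G w₁) _ (G w₂)) n ⟩
    symmetricSeries w₁ w₂ x n                  ∎
    where
    Σq : Series
    Σq = alternatingSum w₁ (q ^ₛ_)

theorem5 : (n w₁ w₂ : ℕ) → w₁ % 2 ≡ 1 → w₂ % 2 ≡ 1 → (x : ℚ) →
    sumBelow w₁ (λ l → sgn l * C n w₁ (ι w₂ * x + frac w₂ w₁ * ι l))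
      ≡ sumBelow w₂ (λ l → sgn l * C n w₂ (ι w₁ * x + frac w₁ w₂ * ι l))
theorem5 n zero     w₂       ()   odd₂ x
theorem5 n (suc b₁) zero     odd₁ ()   x
theorem5 n (suc b₁) (suc b₂) odd₁ odd₂ x =
  ι-suc-cancelˡ 1 _ _ (begin
    two * alternatingCatalanSum n w₁ w₂ x   ≡⟨ DoubledSide.doubled n b₁ w₂ x odd₁ ⟩
    symmetricSeries w₁ w₂ x n              ≡⟨ symmetricSeries-comm w₁ w₂ x n ⟩
    symmetricSeries w₂ w₁ x n              ≡⟨ DoubledSide.doubled n b₂ w₁ x odd₂ ⟨
    two * alternatingCatalanSum n w₂ w₁ x   ∎)
  where
  w₁ w₂ : ℕ
  w₁ = suc b₁
  w₂ = suc b₂
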